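{- For every measurable space $(X,\mathcal{M})$, the lattice $(\mathrm{Sub}^{\mathrm{eq}}_\sigma(\mathcal{M}), \sqsubseteq)$ is atomic, i.e. every element is the supremum (in this lattice) of the atoms below it.
   Context: For an equivalence relation $\sim$ on $X$, $\mathcal{M}_\sim$ is the sub-$\sigma$-algebra of $\sim$-invariant sets of $\mathcal{M}$ (sets in $\mathcal{M}$ that are unions of $\sim$-classes); $\mathrm{Sub}^{\mathrm{eq}}_\sigma(\mathcal{M})$ is the set of all sub-$\sigma$-algebras of this form. The order $\sqsubseteq$ is reverse inclusion ($\mathcal{A} \sqsubseteq \mathcal{A}'$ iff $\mathcal{A} \supseteq \mathcal{A}'$), so the least element is $\mathcal{M}$; with this order it is a complete lattice. An atom is an element that covers the least element (it is strictly above the least element and nothing lies strictly between them). -}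

module Defs where

open import Level using (0ℓ)
open import Data.Nat using (ℕ)
open import Data.Product using (Σ; _×_; ∃)
open import Data.Unit using (⊤)
open import Relation.Nullary using (¬_)
open import Relation.Binary using (Rel; IsEquivalence)

Subset : Set → Set₁
Subset X = X → Set

_≐_ : {X : Set} → Subset X → Subset X → Set
A ≐ B = (∀ x → A x → B x) × (∀ x → B x → A x)

Family : Set → Set₁
Family X = Subset X → Set

-- σ-algebra axioms (membership respects extensional equality of subsets).
record IsSigmaAlgebra {X : Set} (M : Family X) : Set₁ where
  field
    respects-≐ : ∀ {A B} → A ≐ B → M A → M B
    whole      : M (λ _ → ⊤)
    compl      : ∀ {A} → M A → M (λ x → ¬ A x)
    countable∪ : (f : ℕ → Subset X) → (∀ n → M (f n)) → M (λ x → Σ ℕ (λ n → f n x))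

record MeasurableSpace : Set₂ where
  field
    X    : Set
    M    : Family X
    isσ  : IsSigmaAlgebra M

_⊆F_ : {X : Set} → Family X → Family X → Set₁
𝒜 ⊆F ℬ = ∀ A → 𝒜 A → ℬ A

_≡F_ : {X : Set} → Family X → Family X → Set₁
𝒜 ≡F ℬ = (𝒜 ⊆F ℬ) × (ℬ ⊆F 𝒜)

Invariant : {X : Set} → Rel X 0ℓ → Subset X → Set
Invariant {X} _~_ A = ∀ {x y} → x ~ y → A x → A y

Inv : {X : Set} → Family X → Rel X 0ℓ → Family X
Inv M _~_ A = M A × Invariant _~_ A

SubEq : {X : Set} → Family X → Family X → Set₁
SubEq {X} M 𝒜 = Σ (Rel X 0ℓ) (λ _~_ → IsEquivalence _~_ × (𝒜 ≡F Inv M _~_))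

_⊑_ : {X : Set} → Family X → Family X → Set₁
𝒜 ⊑ ℬ = ℬ ⊆F 𝒜

_⊏_ : {X : Set} → Family X → Family X → Set₁
𝒜 ⊏ ℬ = (𝒜 ⊑ ℬ) × ¬ (𝒜 ≡F ℬ)

IsAtom : {X : Set} → Family X → Family X → Set₁
IsAtom M 𝒜 =
  SubEq M 𝒜 × (M ⊏ 𝒜) ×
  (∀ 𝒜′ → SubEq M 𝒜′ → ¬ ((M ⊏ 𝒜′) × (𝒜′ ⊏ 𝒜)))

IsSupOfAtomsBelow : {X : Set} → Family X → Family X → Set₁
IsSupOfAtomsBelow M 𝒜 =
  (∀ ℬ → IsAtom M ℬ → ℬ ⊑ 𝒜 → ℬ ⊑ 𝒜) ×
  (∀ 𝒞 → SubEq M 𝒞 → (∀ ℬ → IsAtom M ℬ → ℬ ⊑ 𝒜 → ℬ ⊑ 𝒞) → 𝒜 ⊑ 𝒞)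

IsAtomic : {X : Set} → Family X → Set₁
IsAtomic M = ∀ 𝒜 → SubEq M 𝒜 → IsSupOfAtomsBelow M 𝒜

module Submission where

-- For points x, y let  Glue x y  be the equivalence relation identifying
-- exactly x and y, and  Glued x y = M_{Glue x y}  the measurable sets that
-- contain both or neither of x, y.
--
--  * Glued x y is an atom as soon as some measurable set separates x and y
--    (glued-isAtom).  If M_≈ lay strictly between M and Glued x y, it would
--    contain a ≈-invariant measurable B separating x and y; for any
--    measurable A separating x and y, B or its complement is an E with
--    A ∪ E and A ∩ E in Glued x y, hence ≈-invariant, which forces A itself
--    to be ≈-invariant (invariant-from-∪-∩).  So M_≈ = M, a contradiction.
--
--  * Given 𝒜 = M_~ and a 𝒞 lying above every atom below 𝒜, each C ∈ 𝒞 is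
--    ~-invariant: if a ~ b, C a and ¬ C b, then Glued a b is an atom below 𝒜
--    (glued-below), so C ∈ Glued a b, i.e. C b.  Hence 𝒞 ⊆ 𝒜.
--
-- Excluded middle is used throughout for case distinctions on membership.

open import Level using (0ℓ; suc; Lift; lift; lower)
open import Axiom.ExcludedMiddle using (ExcludedMiddle)
open import Defs
open import Data.Nat using (ℕ; zero) renaming (suc to sucℕ)
open import Data.Product using (Σ; _×_; _,_; proj₁; proj₂)
open import Data.Sum using (_⊎_; inj₁; inj₂)
open import Data.Empty using (⊥-elim)
open import Relation.Nullary using (¬_; Dec; yes; no)
open import Relation.Nullary.Decidable using (map′)
open import Relation.Binary using (Rel; IsEquivalence; Symmetric)
open import Relation.Binary.PropositionalEquality using (_≡_; refl)

Agree : {X : Set} → Subset X → X → X → Set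
Agree D x y = (D x → D y) × (D y → D x)

Separates : {X : Set} → Subset X → X → X → Set
Separates D x y = D x × ¬ D y

ComplementaryAt : {X : Set} → Subset X → Subset X → X → Set
ComplementaryAt A E z = (A z ⊎ E z) × ¬ (A z × E z)

-- Binary union, written as a countable union so that σ-algebras are closed
-- under it, and intersection via De Morgan for the same reason.
pick : {X : Set} → Subset X → Subset X → ℕ → Subset X
pick A E zero     = A
pick A E (sucℕ _) = E

_∪_ : {X : Set} → Subset X → Subset X → Subset X
(A ∪ E) z = Σ ℕ (λ n → pick A E n z)

∁ : {X : Set} → Subset X → Subset X
∁ A z = ¬ A z

_∩_ : {X : Set} → Subset X → Subset X → Subset X
A ∩ E = ∁ (∁ A ∪ ∁ E)

∪-introˡ : {X : Set} {A E : Subset X} {z : X} → A z → (A ∪ E) z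
∪-introˡ a = zero , a

∪-introʳ : {X : Set} {A E : Subset X} {z : X} → E z → (A ∪ E) z
∪-introʳ e = sucℕ zero , e

∪-elim : {X : Set} {A E : Subset X} {z : X} → (A ∪ E) z → A z ⊎ E z
∪-elim (zero , a)   = inj₁ a
∪-elim (sucℕ _ , e) = inj₂ e

∩-intro : {X : Set} {A E : Subset X} {z : X} → A z → E z → (A ∩ E) z
∩-intro a e u with ∪-elim u
... | inj₁ ¬a = ¬a a
... | inj₂ ¬e = ¬e e

∁-invariant : {X : Set} {_≈_ : Rel X 0ℓ} {D : Subset X} →
              Symmetric _≈_ → Invariant _≈_ D → Invariant _≈_ (∁ D)
∁-invariant sym iD a≈b ¬Da Db = ¬Da (iD (sym a≈b) Db)

OneOf : {X : Set} → X → X → X → Set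
OneOf x y z = z ≡ x ⊎ z ≡ y

Glue : {X : Set} → X → X → Rel X 0ℓ
Glue x y a b = a ≡ b ⊎ (OneOf x y a × OneOf x y b)

glue-isEquivalence : {X : Set} (x y : X) → IsEquivalence (Glue x y)
glue-isEquivalence x y = record { refl = inj₁ refl ; sym = sym ; trans = trans }
  where
  sym : ∀ {a b} → Glue x y a b → Glue x y b a
  sym (inj₁ refl)     = inj₁ refl
  sym (inj₂ (p , q))  = inj₂ (q , p)
  trans : ∀ {a b c} → Glue x y a b → Glue x y b c → Glue x y a c
  trans (inj₁ refl) h                  = h
  trans (inj₂ pq) (inj₁ refl)          = inj₂ pq
  trans (inj₂ (p , _)) (inj₂ (_ , r))  = inj₂ (p , r)

agree⇒glue-invariant : {X : Set} {x y : X} {D : Subset X} →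
                       Agree D x y → Invariant (Glue x y) D
agree⇒glue-invariant _ (inj₁ refl) d                          = d
agree⇒glue-invariant _ (inj₂ (inj₁ refl , inj₁ refl)) d       = d
agree⇒glue-invariant (x→y , _) (inj₂ (inj₁ refl , inj₂ refl)) d = x→y d
agree⇒glue-invariant (_ , y→x) (inj₂ (inj₂ refl , inj₁ refl)) d = y→x d
agree⇒glue-invariant _ (inj₂ (inj₂ refl , inj₂ refl)) d       = d

glue-invariant⇒transfer : {X : Set} {x y : X} {D : Subset X} →
                          Invariant (Glue x y) D → D x → D y
glue-invariant⇒transfer iD = iD (inj₂ (inj₁ refl , inj₂ refl))

module _ (em : ExcludedMiddle (suc 0ℓ)) where

  decide : (Q : Set) → Dec Q
  decide Q = map′ lower lift (em {Lift (suc 0ℓ) Q})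

  byContradiction : {Q : Set} → ¬ ¬ Q → Q
  byContradiction {Q} ¬¬q with decide Q
  ... | yes q = q
  ... | no ¬q = ⊥-elim (¬¬q ¬q)

  nonInclusion-witness : {X : Set} {𝒜 ℬ : Family X} →
                         ¬ (𝒜 ⊆F ℬ) → Σ (Subset X) (λ B → 𝒜 B × ¬ ℬ B)
  nonInclusion-witness {X} {𝒜} {ℬ} 𝒜⊈ℬ with em {Σ (Subset X) (λ B → 𝒜 B × ¬ ℬ B)}
  ... | yes w = w
  ... | no ¬w = ⊥-elim (𝒜⊈ℬ λ B B∈𝒜 → byContradiction λ B∉ℬ → ¬w (B , B∈𝒜 , B∉ℬ))

  agree-or-separate : {X : Set} (D : Subset X) (x y : X) →
                      Agree D x y ⊎ Separates D x y ⊎ Separates D y x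
  agree-or-separate D x y with decide (D x) | decide (D y)
  ... | yes dx | yes dy = inj₁ ((λ _ → dy) , (λ _ → dx))
  ... | no ¬dx | no ¬dy = inj₁ ((λ dx → ⊥-elim (¬dx dx)) , (λ dy → ⊥-elim (¬dy dy)))
  ... | yes dx | no ¬dy = inj₂ (inj₁ (dx , ¬dy))
  ... | no ¬dx | yes dy = inj₂ (inj₂ (dy , ¬dx))

  ∩-projˡ : {X : Set} {A E : Subset X} {z : X} → (A ∩ E) z → A z
  ∩-projˡ i = byContradiction λ ¬a → i (∪-introˡ ¬a)

  -- The combinatorial core: A is recovered from E, A ∪ E and A ∩ E
  -- (A = (A ∩ E) ∪ ((A ∪ E) ∖ E)), so invariance passes to A.
  invariant-from-∪-∩ : {X : Set} {_≈_ : Rel X 0ℓ} {A E : Subset X} →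
                       Symmetric _≈_ → Invariant _≈_ E →
                       Invariant _≈_ (A ∪ E) → Invariant _≈_ (A ∩ E) →
                       Invariant _≈_ A
  invariant-from-∪-∩ {E = E} sym iE i∪ i∩ {a} a≈b Aa with decide (E a)
  ... | yes Ea = ∩-projˡ (i∩ a≈b (∩-intro Aa Ea))
  ... | no ¬Ea with ∪-elim (i∪ a≈b (∪-introˡ Aa))
  ...   | inj₁ Ab = Ab
  ...   | inj₂ Eb = ⊥-elim (¬Ea (iE (sym a≈b) Eb))

  module _ (S : MeasurableSpace) where
    open MeasurableSpace S
    open IsSigmaAlgebra isσ

    ∪-measurable : {A E : Subset X} → M A → M E → M (A ∪ E)
    ∪-measurable {A} {E} mA mE =
      countable∪ (pick A E) λ { zero → mA ; (sucℕ _) → mE }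

    ∩-measurable : {A E : Subset X} → M A → M E → M (A ∩ E)
    ∩-measurable mA mE = compl (∪-measurable (compl mA) (compl mE))

    Glued : X → X → Family X
    Glued x y = Inv M (Glue x y)

    glued-below : {_~_ : Rel X 0ℓ} → Symmetric _~_ → {a b : X} → a ~ b →
                  Glued a b ⊑ Inv M _~_
    glued-below sym a~b A (mA , iA) =
      mA , agree⇒glue-invariant (iA a~b , iA (sym a~b))

    module Maximality {_≈_ : Rel X 0ℓ} (sym : Symmetric _≈_) {x y : X}
                      (glued-invariant : ∀ A → Glued x y A → Invariant _≈_ A)
                      {B : Subset X} (mB : M B) (iB : Invariant _≈_ B)
                      (B-separates : Separates B x y) where

      -- A measurable E, ≈-invariant and complementary to A at x and y,
      -- makes A ∪ E contain both points and A ∩ E neither.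
      complementary⇒invariant : {A E : Subset X} → M A → M E →
                                Invariant _≈_ E → ComplementaryAt A E x →
                                ComplementaryAt A E y → Invariant _≈_ A
      complementary⇒invariant {A} {E} mA mE iE (ax⊎ex , ¬axex) (ay⊎ey , ¬ayey) =
        invariant-from-∪-∩ sym iE
          (glued-invariant (A ∪ E) (∪-measurable mA mE ,
            agree⇒glue-invariant ((λ _ → into-∪ ay⊎ey) , (λ _ → into-∪ ax⊎ex))))
          (glued-invariant (A ∩ E) (∩-measurable mA mE ,
            agree⇒glue-invariant ((λ i → ⊥-elim (¬axex (in-both i)))
                                 , (λ i → ⊥-elim (¬ayey (in-both i))))))
        where
        into-∪ : {z : X} → A z ⊎ E z → (A ∪ E) z
        into-∪ (inj₁ a) = ∪-introˡ a
        into-∪ (inj₂ e) = ∪-introʳ e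
        in-both : {z : X} → (A ∩ E) z → A z × E z
        in-both i = ∩-projˡ i , byContradiction λ ¬e → i (∪-introʳ ¬e)

      all-invariant : ∀ A → M A → Invariant _≈_ A
      all-invariant A mA with agree-or-separate A x y
      ... | inj₁ agree = glued-invariant A (mA , agree⇒glue-invariant agree)
      ... | inj₂ (inj₁ (ax , ¬ay)) =
        complementary⇒invariant mA (compl mB) (∁-invariant {_≈_ = _≈_} sym iB)
          (inj₁ ax , λ { (_ , ¬bx) → ¬bx (proj₁ B-separates) })
          (inj₂ (proj₂ B-separates) , λ { (ay , _) → ¬ay ay })
      ... | inj₂ (inj₂ (ay , ¬ax)) =
        complementary⇒invariant mA mB iB
          (inj₂ (proj₁ B-separates) , λ { (ax , _) → ¬ax ax })
          (inj₁ ay , λ { (_ , by) → proj₂ B-separates by })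

    glued-isAtom : {C : Subset X} {x y : X} → M C → Separates C x y →
                   IsAtom M (Glued x y)
    glued-isAtom {C} {x} {y} mC (Cx , ¬Cy) =
      (Glue x y , glue-isEquivalence x y , (λ _ h → h) , (λ _ h → h))
      , ((λ _ → proj₁) , M≢Glued)
      , nothing-between
      where
      M≢Glued : ¬ (M ≡F Glued x y)
      M≢Glued (M⊆Glued , _) = ¬Cy (glue-invariant⇒transfer (proj₂ (M⊆Glued C mC)) Cx)

      nothing-between : ∀ 𝒜′ → SubEq M 𝒜′ → ¬ ((M ⊏ 𝒜′) × (𝒜′ ⊏ Glued x y))
      nothing-between 𝒜′ (_≈_ , ≈-equiv , (to , from))
                      ((𝒜′⊆M , M≢𝒜′) , (Glued⊆𝒜′ , 𝒜′≢Glued)) =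
        M≢𝒜′ (M⊆𝒜′ , 𝒜′⊆M)
        where
        open IsEquivalence ≈-equiv using (sym)

        glued-invariant : ∀ A → Glued x y A → Invariant _≈_ A
        glued-invariant A h = proj₂ (to A (Glued⊆𝒜′ A h))

        -- 𝒜′ has a member W outside Glued x y; W is measurable and
        -- ≈-invariant, and W or its complement separates x from y.
        witness : Σ (Subset X) (λ B → 𝒜′ B × ¬ Glued x y B)
        witness = nonInclusion-witness (λ 𝒜′⊆Glued → 𝒜′≢Glued (𝒜′⊆Glued , Glued⊆𝒜′))

        W : Subset X
        W = proj₁ witness

        mW : M W
        mW = proj₁ (to W (proj₁ (proj₂ witness)))

        iW : Invariant _≈_ W
        iW = proj₂ (to W (proj₁ (proj₂ witness)))

        separating : Σ (Subset X) (λ B → M B × Invariant _≈_ B × Separates B x y)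
        separating with agree-or-separate W x y
        ... | inj₁ agree            = ⊥-elim (proj₂ (proj₂ witness) (mW , agree⇒glue-invariant agree))
        ... | inj₂ (inj₁ sep)       = W , mW , iW , sep
        ... | inj₂ (inj₂ (Wy , ¬Wx)) =
          ∁ W , compl mW , ∁-invariant {_≈_ = _≈_} sym iW , (¬Wx , λ ¬Wy → ¬Wy Wy)

        M⊆𝒜′ : M ⊆F 𝒜′
        M⊆𝒜′ A mA with separating
        ... | _ , mB , iB , B-separates =
          from A (mA , Maximality.all-invariant sym glued-invariant mB iB B-separates A mA)

    atomic : IsAtomic M
    atomic 𝒜 (_~_ , ~-equiv , (to , from)) = (λ _ _ below → below) , least
      where
      open IsEquivalence ~-equiv using (sym)

      least : ∀ 𝒞 → SubEq M 𝒞 → (∀ ℬ → IsAtom M ℬ → ℬ ⊑ 𝒜 → ℬ ⊑ 𝒞) → 𝒜 ⊑ 𝒞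
      least 𝒞 (_ , _ , (to𝒞 , _)) atoms-below C C∈𝒞 = from C (mC , invariant)
        where
        mC : M C
        mC = proj₁ (to𝒞 C C∈𝒞)

        invariant : Invariant _~_ C
        invariant {a} {b} a~b Ca = byContradiction λ ¬Cb →
          let glued-below-𝒜 : Glued a b ⊑ 𝒜
              glued-below-𝒜 A A∈𝒜 = glued-below sym a~b A (to A A∈𝒜)
              C∈Glued : Glued a b C
              C∈Glued = atoms-below (Glued a b) (glued-isAtom mC (Ca , ¬Cb))
                                    glued-below-𝒜 C C∈𝒞
          in ¬Cb (glue-invariant⇒transfer (proj₂ C∈Glued) Ca)

mainTheorem8 : ExcludedMiddle (suc 0ℓ) → (S : MeasurableSpace) → IsAtomic (MeasurableSpace.M S)
mainTheorem8 em S = atomic em S
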